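{- Let $G$ be a graph with line graph $L(G)$, let $t,k$ be positive integers with $k<t$, let $\mathcal T$ be a tangle in $L(G)$ of order $t$, and let $U\subseteq V(G)$. Then there is no $k$-star with center in $U$ which is free with respect to $\mathcal T$ if and only if there exist a positive integer $l$ and subsets $U_1,\dots,U_l\subseteq V(G)$ such that: (1) $U_i\cap U_j=\emptyset$ for $1\le i<j\le l$ and $U\subseteq\bigcup_{i=1}^l U_i$; (2) $|\delta_G(U_i)|<k$ for all $1\le i\le l$; (3) for all $1\le i\le l$, the canonical separation in $L(G)$ for $U_i$ belongs to $\mathcal T$.
   Context: Graphs may have parallel edges but no loops. The line graph $L(G)$ has vertex set $E(G)$, two edges being adjacent if they share an endpoint. $\delta_G(U)$ is the set of edges of $G$ with exactly one end in $U$. A $k$-star is a set $F$ of $k$ edges all sharing a common endpoint $u$, its center; it is regarded as a set of vertices of $L(G)$. A separation of a graph $\Gamma$ is an ordered pair $(A,B)$ of edge-disjoint subgraphs with $A\cup B=\Gamma$, of order $|V(A)\cap V(B)|$. A tangle of order $\Theta$ in $\Gamma$ is a set $\mathcal T$ of separations of order $<\Theta$ such that (i) for each separation $(A,B)$ of order $<\Theta$, one of $(A,B),(B,A)$ is in $\mathcal T$; (ii) no three members $(A_i,B_i)$ of $\mathcal T$ satisfy $A_1\cup A_2\cup A_3=\Gamma$; (iii) $V(A)\ne V(\Gamma)$ for $(A,B)\in\mathcal T$. A set $X$ of vertices is free with respect to $\mathcal T$ if there is no $(A,B)\in\mathcal T$ of order $<|X|$ with $X\subseteq V(A)$. For $U\subseteq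 V(G)$, the canonical separation in $L(G)$ for $U$ is $(A,B)$ with $A=L(G)[E(G[U])\cup\delta_G(U)]$ and $B=L(G)[E(G-U)\cup\delta_G(U)]-E(L(G)[\delta_G(U)])$. -}

module Defs where

open import Data.Nat using (ℕ; _<_; _<ᵇ_)
open import Data.Bool using (Bool; true; false; _∧_; _∨_; not; _xor_)
open import Data.Fin using (Fin; toℕ; _≟_)
open import Data.Fin.Subset using (Subset; _∈_; _∩_; ∣_∣; _⊆_)
open import Data.Vec using (Vec; lookup; tabulate)
open import Data.Product using (Σ; _×_; ∃; ∃-syntax; _,_)
open import Data.Sum using (_⊎_)
open import Relation.Nullary using (¬_; does)
open import Relation.Binary.PropositionalEquality using (_≡_; _≢_)

record Graph : Set where
  field
    n : ℕ
    m : ℕ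
    src : Fin m → Fin n
    tgt : Fin m → Fin n
    loopless : ∀ e → src e ≢ tgt e

module _ (G : Graph) where
  open Graph G

  _==_ : Fin n → Fin n → Bool
  x == y = does (x ≟ y)

  share : Fin m → Fin m → Bool
  share e f = (src e == src f) ∨ (src e == tgt f) ∨ (tgt e == src f) ∨ (tgt e == tgt f)

  -- The line graph L(G): vertex set E(G) = Fin m; its edges are the
  -- unordered pairs {e,f} of distinct edges of G sharing an endpoint,
  -- each represented canonically by the ordered pair (e,f) with e < f.
  lineEdge : Fin m → Fin m → Bool
  lineEdge e f = (toℕ e <ᵇ toℕ f) ∧ share e f

  -- A (raw) subgraph of L(G): a vertex set and an edge set (as a boolean matrix).
  EdgeSet : Set
  EdgeSet = Vec (Subset m) m

  Subg : Set
  Subg = Subset m × EdgeSet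

  V : Subg → Subset m
  V (vs , _) = vs

  _∈E_ : Fin m × Fin m → Subg → Set
  (e , f) ∈E (_ , es) = lookup (lookup es e) f ≡ true

  IsSubgraph : Subg → Set
  IsSubgraph A = ∀ e f → (e , f) ∈E A → (lineEdge e f ≡ true) × (e ∈ V A) × (f ∈ V A)

  IsSeparation : Subg → Subg → Set
  IsSeparation A B =
    IsSubgraph A × IsSubgraph B
    × (∀ e f → ¬ ((e , f) ∈E A × (e , f) ∈E B))
    × (∀ e → e ∈ V A ⊎ e ∈ V B)
    × (∀ e f → lineEdge e f ≡ true → (e , f) ∈E A ⊎ (e , f) ∈E B)

  order : Subg → Subg → ℕ
  order A B = ∣ V A ∩ V B ∣

  CoverL3 : Subg → Subg → Subg → Set
  CoverL3 A₁ A₂ A₃ =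
    (∀ e → e ∈ V A₁ ⊎ e ∈ V A₂ ⊎ e ∈ V A₃)
    × (∀ e f → lineEdge e f ≡ true → (e , f) ∈E A₁ ⊎ (e , f) ∈E A₂ ⊎ (e , f) ∈E A₃)

  record IsTangle (T : Subg → Subg → Set) (Θ : ℕ) : Set where
    field
      members   : ∀ A B → T A B → IsSeparation A B × order A B < Θ
      orient    : ∀ A B → IsSeparation A B → order A B < Θ → T A B ⊎ T B A
      noCover   : ∀ A₁ B₁ A₂ B₂ A₃ B₃ → T A₁ B₁ → T A₂ B₂ → T A₃ B₃ → ¬ CoverL3 A₁ A₂ A₃
      notWhole  : ∀ A B → T A B → ¬ (∀ e → e ∈ V A)

  Free : (Subg → Subg → Set) → Subset m → Set
  Free T X = ¬ (Σ Subg λ A → Σ Subg λ B → T A B × order A B < ∣ X ∣ × X ⊆ V A)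

  incident : Fin m → Fin n → Set
  incident e u = (src e ≡ u) ⊎ (tgt e ≡ u)

  IsStar : ℕ → Fin n → Subset m → Set
  IsStar k u F = ∣ F ∣ ≡ k × (∀ e → e ∈ F → incident e u)

  δ : Subset n → Subset m
  δ U = tabulate λ e → lookup U (src e) xor lookup U (tgt e)

  -- The canonical separation in L(G) for U.
  -- A = L(G)[E(G[U]) ∪ δ(U)] : vertices = edges with at least one end in U.
  canA : Subset n → Subg
  canA U = (tabulate AV , tabulate λ e → tabulate λ f → lineEdge e f ∧ AV e ∧ AV f)
    where
    AV : Fin m → Bool
    AV e = lookup U (src e) ∨ lookup U (tgt e)

  -- B = L(G)[E(G-U) ∪ δ(U)] - E(L(G)[δ(U)]) : vertices = edges with at least
  -- one end outside U; edges = those of the induced subgraph not joining two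
  -- members of δ(U).
  canB : Subset n → Subg
  canB U = (tabulate BV , tabulate λ e → tabulate λ f →
              lineEdge e f ∧ BV e ∧ BV f ∧ not (lookup (δ U) e ∧ lookup (δ U) f))
    where
    BV : Fin m → Bool
    BV e = not (lookup U (src e)) ∨ not (lookup U (tgt e))

module Submission where

-- Call W ⊆ V(G) good if |δ(W)| < k and the canonical separation for W lies in 𝒯.
-- (⇐) A k-star F centred in a good Uᵢ lies in the first side of the canonical separation for Uᵢ,
-- whose order |δ(Uᵢ)| is less than |F|; so F is not free.
-- (⇒) Every u ∈ U lies in a good set. Either δ({u}) is already small, or a k-star F ⊆ δ({u}) is
-- blocked by some (A,B) ∈ 𝒯 of order < k with F ⊆ V(A). Some edge of F then misses V(B), and since an
-- edge only in A is never adjacent to one only in B, the set of vertices all of whose edges lie in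
-- V(A) contains u and has its boundary inside V(A) ∩ V(B). Its canonical separation is in 𝒯, as the
-- reverse, together with (A,B) and the separation cutting off the clique V(A) ∩ V(B), would cover L(G).
-- Good sets stay good when shrunk without enlarging the boundary, and posimodularity
-- |δ(X∖W)| + |δ(W∖X)| ≤ |δ(X)| + |δ(W)| turns two good sets into disjoint good sets with the same
-- union; inserting the good neighbourhoods one at a time yields the required disjoint family.

open import Defs
open import Algebra.Properties.CommutativeSemigroup using (interchange)
open import Data.Bool using (Bool; true; false; _∧_; _∨_; not; _xor_; if_then_else_)
open import Data.Bool.Properties using (∧-conicalˡ; ∧-conicalʳ; ∧-zeroʳ; ∧-identityʳ; ∨-zeroʳ; ¬-not; T-≡)
open import Data.Empty using (⊥)
open import Data.Fin using (Fin; zero; suc; _≟_; toℕ)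
open import Data.Fin.Properties using (toℕ-injective; all?; any?; ¬∀⟶∃¬)
open import Data.Fin.Subset using (Subset; inside; outside; _∈_; _∉_; _⊆_; ∣_∣; _∩_; _─_; ⊤; ⁅_⁆) renaming (⊥ to ∅)
open import Data.Fin.Subset.Properties using (_∈?_; anySubset?; ∈⊤; ∉⊥; ⊥⊆; ∣⊥∣≡0; out⊆; in⊆in; ⊆-antisym; p⊆q⇒∣p∣≤∣q∣; x∈p∩q⁺; x∈p∩q⁻; ∣p∩q∣≤∣p∣; p─q⊆p; x∈p∧x∉q⇒x∈p─q; x∈⁅x⁆; x∈⁅y⁆⇒x≡y)
open import Data.Nat using (ℕ; zero; suc; _+_; _≤_; _<_; z≤n; s≤s)
open import Data.Nat.Properties using (_≤?_; _<?_; <-cmp; <⇒<ᵇ; ≤ᵇ⇒≤; ≤-<-trans; <-trans; ≮⇒≥; <⇒≱; ≰⇒>; +-mono-≤; +-mono-<; +-commutativeSemigroup; module ≤-Reasoning)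
open import Data.Product using (Σ; _×_; _,_; proj₁; proj₂)
open import Data.Sum using (_⊎_; inj₁; inj₂; [_,_]′; map₂; swap)
open import Data.Vec using (_∷_; lookup; tabulate; here; there)
open import Data.Vec.Functional using () renaming (_∷_ to _∷ᶠ_)
open import Data.Vec.Properties using (lookup∘tabulate; []=⇒lookup; lookup⇒[]=)
open import Function using (_∘_; id; const)
open import Function.Bundles using (Equivalence; _⇔_; mk⇔)
open import Relation.Binary.Definitions using (tri<; tri≈; tri>)
open import Relation.Binary.PropositionalEquality using (_≡_; _≢_; refl; sym; trans; cong; cong₂; subst; subst₂)
open import Relation.Nullary using (Dec; yes; no; does; ¬_; contradiction)
open import Relation.Nullary.Decidable using (dec-true; decidable-stable; map′; ¬?; _×-dec_; _⊎-dec_; _→-dec_)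
open import Relation.Unary using (Pred; Decidable)

χ : Bool → ℕ
χ b = if b then 1 else 0

∣b∷p∣≡χb+∣p∣ : ∀ {n} b (p : Subset n) → ∣ b ∷ p ∣ ≡ χ b + ∣ p ∣
∣b∷p∣≡χb+∣p∣ true  p = refl
∣b∷p∣≡χb+∣p∣ false p = refl

∣tabulate∣-+-mono : ∀ {m} {f g h k : Fin m → Bool} → (∀ i → χ (f i) + χ (g i) ≤ χ (h i) + χ (k i))
  → ∣ tabulate f ∣ + ∣ tabulate g ∣ ≤ ∣ tabulate h ∣ + ∣ tabulate k ∣
∣tabulate∣-+-mono {zero} _ = z≤n
∣tabulate∣-+-mono {suc m} {f} {g} {h} {k} le = begin
  ∣ tabulate f ∣ + ∣ tabulate g ∣
    ≡⟨ cong₂ _+_ (∣b∷p∣≡χb+∣p∣ (f zero) (tabulate (f ∘ suc))) (∣b∷p∣≡χb+∣p∣ (g zero) (tabulate (g ∘ suc))) ⟩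
  (χ (f zero) + ∣ tabulate (f ∘ suc) ∣) + (χ (g zero) + ∣ tabulate (g ∘ suc) ∣)
    ≡⟨ interchange +-commutativeSemigroup (χ (f zero)) _ (χ (g zero)) _ ⟩
  (χ (f zero) + χ (g zero)) + (∣ tabulate (f ∘ suc) ∣ + ∣ tabulate (g ∘ suc) ∣)
    ≤⟨ +-mono-≤ (le zero) (∣tabulate∣-+-mono (le ∘ suc)) ⟩
  (χ (h zero) + χ (k zero)) + (∣ tabulate (h ∘ suc) ∣ + ∣ tabulate (k ∘ suc) ∣)
    ≡⟨ interchange +-commutativeSemigroup (χ (h zero)) (χ (k zero)) _ _ ⟩
  (χ (h zero) + ∣ tabulate (h ∘ suc) ∣) + (χ (k zero) + ∣ tabulate (k ∘ suc) ∣)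
    ≡⟨ cong₂ _+_ (∣b∷p∣≡χb+∣p∣ (h zero) (tabulate (h ∘ suc))) (∣b∷p∣≡χb+∣p∣ (k zero) (tabulate (k ∘ suc))) ⟨
  ∣ tabulate h ∣ + ∣ tabulate k ∣ ∎
  where open ≤-Reasoning

∈-tabulate⁺ : ∀ {n} {f : Fin n → Bool} {x} → f x ≡ true → x ∈ tabulate f
∈-tabulate⁺ {f = f} {x} fx = lookup⇒[]= x (tabulate f) (trans (lookup∘tabulate f x) fx)

∈-tabulate⁻ : ∀ {n} {f : Fin n → Bool} {x} → x ∈ tabulate f → f x ≡ true
∈-tabulate⁻ {f = f} {x} x∈ = trans (sym (lookup∘tabulate f x)) ([]=⇒lookup x∈)

∈-tabulate-does⁺ : ∀ {n p} {P : Pred (Fin n) p} (P? : Decidable P) {x} → P x → x ∈ tabulate (does ∘ P?)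
∈-tabulate-does⁺ P? {x} px = ∈-tabulate⁺ (dec-true (P? x) px)

∈-tabulate-does⁻ : ∀ {n p} {P : Pred (Fin n) p} (P? : Decidable P) {x} → x ∈ tabulate (does ∘ P?) → P x
∈-tabulate-does⁻ P? {x} x∈ with P? x | ∈-tabulate⁻ x∈
... | yes px | _ = px

∧≡true⁻ : ∀ a {b} → a ∧ b ≡ true → a ≡ true × b ≡ true
∧≡true⁻ a h = ∧-conicalˡ a _ h , ∧-conicalʳ a _ h

∉⇒lookup≡false : ∀ {n} {p : Subset n} {x} → x ∉ p → lookup p x ≡ false
∉⇒lookup≡false {p = p} {x} x∉p = ¬-not (x∉p ∘ lookup⇒[]= x p)

lookup≡false⇒∉ : ∀ {n} {p : Subset n} {x} → lookup p x ≡ false → x ∉ p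
lookup≡false⇒∉ px≡false x∈p with () ← trans (sym ([]=⇒lookup x∈p)) px≡false

lookup²∘tabulate² : ∀ {m n} {A : Set} (h : Fin m → Fin n → A) i j →
  lookup (lookup (tabulate λ i → tabulate (h i)) i) j ≡ h i j
lookup²∘tabulate² h i j = trans (cong (λ v → lookup v j) (lookup∘tabulate _ i)) (lookup∘tabulate (h i) j)

x∈p─q⇒x∉q : ∀ {n} {p q : Subset n} {x} → x ∈ p ─ q → x ∉ q
x∈p─q⇒x∉q {p = _ ∷ _} {inside ∷ _}  ()          here
x∈p─q⇒x∉q {p = _ ∷ _} {_ ∷ _}       (there x∈)  (there x∈q) = x∈p─q⇒x∉q x∈ x∈q

lookup-─ : ∀ {n} (p q : Subset n) x → lookup (p ─ q) x ≡ lookup p x ∧ not (lookup q x)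
lookup-─ (s ∷ _) (inside  ∷ _) zero    = sym (∧-zeroʳ s)
lookup-─ (s ∷ _) (outside ∷ _) zero    = sym (∧-identityʳ s)
lookup-─ (_ ∷ p) (_       ∷ q) (suc x) = lookup-─ p q x

-- Posimodularity of the cut function at one edge: a, b say whether its source lies in X, W,
-- and c, d the same for its target.
posimodularᵇ : ∀ a b c d →
  χ ((a ∧ not b) xor (c ∧ not d)) + χ ((b ∧ not a) xor (d ∧ not c)) ≤ χ (a xor c) + χ (b xor d)
posimodularᵇ false false false false = ≤ᵇ⇒≤ _ _ _
posimodularᵇ false false false true  = ≤ᵇ⇒≤ _ _ _
posimodularᵇ false false true  false = ≤ᵇ⇒≤ _ _ _
posimodularᵇ false false true  true  = ≤ᵇ⇒≤ _ _ _
posimodularᵇ false true  false false = ≤ᵇ⇒≤ _ _ _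
posimodularᵇ false true  false true  = ≤ᵇ⇒≤ _ _ _
posimodularᵇ false true  true  false = ≤ᵇ⇒≤ _ _ _
posimodularᵇ false true  true  true  = ≤ᵇ⇒≤ _ _ _
posimodularᵇ true  false false false = ≤ᵇ⇒≤ _ _ _
posimodularᵇ true  false false true  = ≤ᵇ⇒≤ _ _ _
posimodularᵇ true  false true  false = ≤ᵇ⇒≤ _ _ _
posimodularᵇ true  false true  true  = ≤ᵇ⇒≤ _ _ _
posimodularᵇ true  true  false false = ≤ᵇ⇒≤ _ _ _
posimodularᵇ true  true  false true  = ≤ᵇ⇒≤ _ _ _
posimodularᵇ true  true  true  false = ≤ᵇ⇒≤ _ _ _
posimodularᵇ true  true  true  true  = ≤ᵇ⇒≤ _ _ _

_∈⋃_ : ∀ {n l} → Fin n → (Fin l → Subset n) → Set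
x ∈⋃ g = Σ (Fin _) λ i → x ∈ g i

⊆-of-size : ∀ {n} (p : Subset n) {k} → k ≤ ∣ p ∣ → Σ (Subset n) λ q → q ⊆ p × ∣ q ∣ ≡ k
⊆-of-size {n} p {zero} _ = ∅ , ⊥⊆ , ∣⊥∣≡0 n
⊆-of-size (outside ∷ p) {suc k} k<∣p∣ with ⊆-of-size p k<∣p∣
... | q , q⊆p , ∣q∣≡k = outside ∷ q , out⊆ q⊆p , ∣q∣≡k
⊆-of-size (inside ∷ p) {suc k} (s≤s k≤∣p∣) with ⊆-of-size p k≤∣p∣
... | q , q⊆p , ∣q∣≡k = inside ∷ q , in⊆in q⊆p , cong suc ∣q∣≡k

+-≤-split : ∀ {a b c d} → a + b ≤ c + d → a ≤ c ⊎ b ≤ d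
+-≤-split {a} {b} {c} {d} le with a ≤? c | b ≤? d
... | yes a≤c | _       = inj₁ a≤c
... | no _    | yes b≤d = inj₂ b≤d
... | no a≰c  | no b≰d  = contradiction le (<⇒≱ (+-mono-< (≰⇒> a≰c) (≰⇒> b≰d)))

module _ (G : Graph) where
  open Graph G

  incident? : ∀ e x → Dec (incident G e x)
  incident? e x = (src e ≟ x) ⊎-dec (tgt e ≟ x)

  common-end⇒share : ∀ {e f w} → incident G e w → incident G f w → share G e f ≡ true
  common-end⇒share {e} {f} ie if with src e ≟ src f | src e ≟ tgt f | tgt e ≟ src f | tgt e ≟ tgt f
  ... | yes _ | _     | _     | _     = refl
  ... | no _  | yes _ | _     | _     = refl
  ... | no _  | no _  | yes _ | _     = refl
  ... | no _  | no _  | no _  | yes _ = refl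
  ... | no ss | no st | no ts | no tt with ie | if
  ...   | inj₁ p | inj₁ q = contradiction (trans p (sym q)) ss
  ...   | inj₁ p | inj₂ q = contradiction (trans p (sym q)) st
  ...   | inj₂ p | inj₁ q = contradiction (trans p (sym q)) ts
  ...   | inj₂ p | inj₂ q = contradiction (trans p (sym q)) tt

  share⇒common-end : ∀ {e f} → share G e f ≡ true → Σ (Fin n) λ w → incident G e w × incident G f w
  share⇒common-end {e} {f} h with src e ≟ src f | src e ≟ tgt f | tgt e ≟ src f | tgt e ≟ tgt f
  ... | yes p | _     | _     | _     = src e , inj₁ refl , inj₁ (sym p)
  ... | no _  | yes p | _     | _     = src e , inj₁ refl , inj₂ (sym p)
  ... | no _  | no _  | yes p | _     = tgt e , inj₂ refl , inj₁ (sym p)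
  ... | no _  | no _  | no _  | yes p = tgt e , inj₂ refl , inj₂ (sym p)

  lineEdge⇒common-end : ∀ {e f} → lineEdge G e f ≡ true → Σ (Fin n) λ w → incident G e w × incident G f w
  lineEdge⇒common-end l = share⇒common-end (∧-conicalʳ _ _ l)

  common-end⇒lineEdge : ∀ {e f w} → e ≢ f → incident G e w → incident G f w
    → lineEdge G e f ≡ true ⊎ lineEdge G f e ≡ true
  common-end⇒lineEdge {e} {f} e≢f ie if with <-cmp (toℕ e) (toℕ f)
  ... | tri< e<f _ _ = inj₁ (cong₂ _∧_ (Equivalence.to T-≡ (<⇒<ᵇ e<f)) (common-end⇒share ie if))
  ... | tri≈ _ e≡f _ = contradiction (toℕ-injective e≡f) e≢f
  ... | tri> _ _ f<e = inj₂ (cong₂ _∧_ (Equivalence.to T-≡ (<⇒<ᵇ f<e)) (common-end⇒share if ie))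

  separation-nonadjacent : ∀ {A B e f w} → IsSeparation G A B → incident G e w → incident G f w
    → e ∉ V G A → f ∉ V G B → ⊥
  separation-nonadjacent {A} {B} {e} {f} (subA , subB , _ , covV , covE) ie if e∉A f∉B =
    [ forward , backward ]′ (common-end⇒lineEdge e≢f ie if)
    where
    e≢f : e ≢ f
    e≢f refl = [ e∉A , f∉B ]′ (covV e)
    forward : lineEdge G e f ≡ true → ⊥
    forward l = [ e∉A ∘ proj₁ ∘ proj₂ ∘ subA e f , f∉B ∘ proj₂ ∘ proj₂ ∘ subB e f ]′ (covE e f l)
    backward : lineEdge G f e ≡ true → ⊥
    backward l = [ e∉A ∘ proj₂ ∘ proj₂ ∘ subA f e , f∉B ∘ proj₁ ∘ proj₂ ∘ subB f e ]′ (covE f e l)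

  module _ {W : Subset n} where

    private
      meets leaves : Fin m → Bool
      meets e = lookup W (src e) ∨ lookup W (tgt e)
      leaves e = not (lookup W (src e)) ∨ not (lookup W (tgt e))

    ∈VcanA⁺ : ∀ {e x} → incident G e x → x ∈ W → e ∈ V G (canA G W)
    ∈VcanA⁺ {e} (inj₁ refl) x∈W = ∈-tabulate⁺ (cong (_∨ lookup W (tgt e)) ([]=⇒lookup x∈W))
    ∈VcanA⁺ {e} (inj₂ refl) x∈W = ∈-tabulate⁺ (trans (cong (lookup W (src e) ∨_) ([]=⇒lookup x∈W)) (∨-zeroʳ _))

    ∈VcanA⁻ : ∀ {e} → e ∈ V G (canA G W) → Σ (Fin n) λ x → incident G e x × x ∈ W
    ∈VcanA⁻ {e} e∈A with lookup W (src e) in s | lookup W (tgt e) in t | ∈-tabulate⁻ e∈A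
    ... | true  | _    | _ = src e , inj₁ refl , lookup⇒[]= _ W s
    ... | false | true | _ = tgt e , inj₂ refl , lookup⇒[]= _ W t

    ∈VcanB⁺ : ∀ {e x} → incident G e x → x ∉ W → e ∈ V G (canB G W)
    ∈VcanB⁺ {e} (inj₁ refl) x∉W = ∈-tabulate⁺ (cong (λ b → not b ∨ not (lookup W (tgt e))) (∉⇒lookup≡false x∉W))
    ∈VcanB⁺ {e} (inj₂ refl) x∉W =
      ∈-tabulate⁺ (trans (cong (λ b → not (lookup W (src e)) ∨ not b) (∉⇒lookup≡false x∉W)) (∨-zeroʳ _))

    ∈δ⁺ : ∀ {e} → e ∈ V G (canA G W) → e ∈ V G (canB G W) → e ∈ δ G W
    ∈δ⁺ {e} e∈A e∈B with lookup W (src e) in s | lookup W (tgt e) in t | ∈-tabulate⁻ e∈A | ∈-tabulate⁻ e∈B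
    ... | true  | false | _ | _ = ∈-tabulate⁺ (cong₂ _xor_ s t)
    ... | false | true  | _ | _ = ∈-tabulate⁺ (cong₂ _xor_ s t)

    ∈δ⁻ : ∀ {e} → e ∈ δ G W → Σ (Fin n) λ x → Σ (Fin n) λ y → incident G e x × incident G e y × x ∈ W × y ∉ W
    ∈δ⁻ {e} e∈δ with lookup W (src e) in s | lookup W (tgt e) in t | ∈-tabulate⁻ e∈δ
    ... | true  | false | _ = src e , tgt e , inj₁ refl , inj₂ refl , lookup⇒[]= _ W s , lookup≡false⇒∉ t
    ... | false | true  | _ = tgt e , src e , inj₂ refl , inj₁ refl , lookup⇒[]= _ W t , lookup≡false⇒∉ s

    ∉VcanA⇒∈VcanB : ∀ {e} → e ∉ V G (canA G W) → e ∈ V G (canB G W)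
    ∉VcanA⇒∈VcanB {e} e∉A = ∈VcanB⁺ (inj₁ refl) (e∉A ∘ ∈VcanA⁺ (inj₁ refl))

    ∉VcanA⇒∉δ : ∀ {e} → e ∉ V G (canA G W) → lookup (δ G W) e ≡ false
    ∉VcanA⇒∉δ e∉A = ∉⇒lookup≡false λ e∈δ → let _ , _ , ie , _ , x∈W , _ = ∈δ⁻ e∈δ in e∉A (∈VcanA⁺ ie x∈W)

    ∈EcanA⁺ : ∀ {e f} → lineEdge G e f ≡ true → e ∈ V G (canA G W) → f ∈ V G (canA G W) → _∈E_ G (e , f) (canA G W)
    ∈EcanA⁺ {e} {f} l e∈A f∈A = trans (lookup²∘tabulate² _ e f)
      (cong₂ _∧_ l (cong₂ _∧_ (∈-tabulate⁻ e∈A) (∈-tabulate⁻ f∈A)))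

    ∈EcanB⁺ : ∀ {e f} → lineEdge G e f ≡ true → e ∉ V G (canA G W) ⊎ f ∉ V G (canA G W) → _∈E_ G (e , f) (canB G W)
    ∈EcanB⁺ {e} {f} l leaves with lineEdge⇒common-end l
    ... | w , ie , if = trans (lookup²∘tabulate² _ e f)
      (cong₂ _∧_ l (cong₂ _∧_ (∈-tabulate⁻ (∈VcanB⁺ ie w∉W)) (cong₂ _∧_ (∈-tabulate⁻ (∈VcanB⁺ if w∉W)) notBoth)))
      where
      w∉W : w ∉ W
      w∉W w∈W = [ (λ e∉A → e∉A (∈VcanA⁺ ie w∈W)) , (λ f∉A → f∉A (∈VcanA⁺ if w∈W)) ]′ leaves
      notBoth : not (lookup (δ G W) e ∧ lookup (δ G W) f) ≡ true
      notBoth = [ (λ e∉A → cong (λ b → not (b ∧ _)) (∉VcanA⇒∉δ e∉A))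
                , (λ f∉A → cong not (trans (cong (_ ∧_) (∉VcanA⇒∉δ f∉A)) (∧-zeroʳ _))) ]′ leaves

    ∈EcanA⁻ : ∀ {e f} → _∈E_ G (e , f) (canA G W)
      → lineEdge G e f ≡ true × e ∈ V G (canA G W) × f ∈ V G (canA G W)
    ∈EcanA⁻ {e} {f} h
      with l , e∧f ← ∧≡true⁻ (lineEdge G e f) (trans (sym (lookup²∘tabulate² _ e f)) h)
      with me , mf ← ∧≡true⁻ (meets e) e∧f = l , ∈-tabulate⁺ me , ∈-tabulate⁺ mf

    ∈EcanB⁻ : ∀ {e f} → _∈E_ G (e , f) (canB G W)
      → lineEdge G e f ≡ true × e ∈ V G (canB G W) × f ∈ V G (canB G W)
        × not (lookup (δ G W) e ∧ lookup (δ G W) f) ≡ true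
    ∈EcanB⁻ {e} {f} h
      with l , rest ← ∧≡true⁻ (lineEdge G e f) (trans (sym (lookup²∘tabulate² _ e f)) h)
      with le , rest ← ∧≡true⁻ (leaves e) rest
      with lf , apart ← ∧≡true⁻ (leaves f) rest = l , ∈-tabulate⁺ le , ∈-tabulate⁺ lf , apart

    canonical-isSeparation : IsSeparation G (canA G W) (canB G W)
    canonical-isSeparation = (λ _ _ → ∈EcanA⁻) , (λ _ _ h → let l , e∈B , f∈B , _ = ∈EcanB⁻ h in l , e∈B , f∈B)
                           , disjoint , covV , covE
      where
      disjoint : ∀ e f → ¬ (_∈E_ G (e , f) (canA G W) × _∈E_ G (e , f) (canB G W))
      disjoint e f (hA , hB) with _ , e∈A , f∈A ← ∈EcanA⁻ hA | _ , e∈B , f∈B , apart ← ∈EcanB⁻ hB =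
        contradiction (trans (sym apart) (cong₂ (λ a b → not (a ∧ b)) ([]=⇒lookup (∈δ⁺ e∈A e∈B)) ([]=⇒lookup (∈δ⁺ f∈A f∈B))))
          λ ()
      covV : ∀ e → e ∈ V G (canA G W) ⊎ e ∈ V G (canB G W)
      covV e with e ∈? V G (canA G W)
      ... | yes e∈A = inj₁ e∈A
      ... | no e∉A  = inj₂ (∉VcanA⇒∈VcanB e∉A)
      covE : ∀ e f → lineEdge G e f ≡ true → _∈E_ G (e , f) (canA G W) ⊎ _∈E_ G (e , f) (canB G W)
      covE e f l with e ∈? V G (canA G W) | f ∈? V G (canA G W)
      ... | yes e∈A | yes f∈A = inj₁ (∈EcanA⁺ l e∈A f∈A)
      ... | no e∉A  | _       = inj₂ (∈EcanB⁺ l (inj₁ e∉A))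
      ... | yes _   | no f∉A  = inj₂ (∈EcanB⁺ l (inj₂ f∉A))

    canonical-order : order G (canA G W) (canB G W) ≡ ∣ δ G W ∣
    canonical-order = cong ∣_∣ (⊆-antisym A∩B⊆δ δ⊆A∩B)
      where
      A∩B⊆δ : V G (canA G W) ∩ V G (canB G W) ⊆ δ G W
      A∩B⊆δ e∈A∩B = let e∈A , e∈B = x∈p∩q⁻ _ _ e∈A∩B in ∈δ⁺ e∈A e∈B
      δ⊆A∩B : δ G W ⊆ V G (canA G W) ∩ V G (canB G W)
      δ⊆A∩B e∈δ = let _ , _ , ix , iy , x∈W , y∉W = ∈δ⁻ e∈δ in x∈p∩q⁺ (∈VcanA⁺ ix x∈W , ∈VcanB⁺ iy y∉W)

  clique coclique : Subset m → Subg G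
  clique S = S , tabulate λ e → tabulate λ f → lineEdge G e f ∧ lookup S e ∧ lookup S f
  coclique S = ⊤ , tabulate λ e → tabulate λ f → lineEdge G e f ∧ not (lookup S e ∧ lookup S f)

  module _ {S : Subset m} where

    ∈Eclique⁺ : ∀ {e f} → lineEdge G e f ≡ true → e ∈ S → f ∈ S → _∈E_ G (e , f) (clique S)
    ∈Eclique⁺ {e} {f} l e∈S f∈S =
      trans (lookup²∘tabulate² _ e f) (cong₂ _∧_ l (cong₂ _∧_ ([]=⇒lookup e∈S) ([]=⇒lookup f∈S)))

    ∈Eclique⁻ : ∀ {e f} → _∈E_ G (e , f) (clique S) → lineEdge G e f ≡ true × lookup S e ∧ lookup S f ≡ true
    ∈Eclique⁻ {e} {f} h = ∧≡true⁻ (lineEdge G e f) (trans (sym (lookup²∘tabulate² _ e f)) h)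

    ∈Ecoclique⁻ : ∀ {e f} → _∈E_ G (e , f) (coclique S) → lineEdge G e f ≡ true × not (lookup S e ∧ lookup S f) ≡ true
    ∈Ecoclique⁻ {e} {f} h = ∧≡true⁻ (lineEdge G e f) (trans (sym (lookup²∘tabulate² _ e f)) h)

    clique-isSeparation : IsSeparation G (clique S) (coclique S)
    clique-isSeparation = subX , (λ _ _ h → proj₁ (∈Ecoclique⁻ h) , ∈⊤ , ∈⊤) , disjoint , (λ _ → inj₂ ∈⊤) , covE
      where
      subX : IsSubgraph G (clique S)
      subX e f h with l , both ← ∈Eclique⁻ h with e∈S , f∈S ← ∧≡true⁻ (lookup S e) both =
        l , lookup⇒[]= e S e∈S , lookup⇒[]= f S f∈S
      disjoint : ∀ e f → ¬ (_∈E_ G (e , f) (clique S) × _∈E_ G (e , f) (coclique S))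
      disjoint e f (hX , hY) = contradiction (trans (sym (proj₂ (∈Ecoclique⁻ hY))) (cong not (proj₂ (∈Eclique⁻ hX)))) λ ()
      covE : ∀ e f → lineEdge G e f ≡ true → _∈E_ G (e , f) (clique S) ⊎ _∈E_ G (e , f) (coclique S)
      covE e f l with lookup S e ∧ lookup S f in both
      ... | true  = inj₁ (trans (lookup²∘tabulate² _ e f) (cong₂ _∧_ l both))
      ... | false = inj₂ (trans (lookup²∘tabulate² _ e f) (cong₂ _∧_ l (cong not both)))

  inner : Subset m → Subset n
  inner F = tabulate λ w → does (all? λ e → incident? e w →-dec e ∈? F)

  module _ {F : Subset m} {w : Fin n} where

    ∈inner⁺ : (∀ e → incident G e w → e ∈ F) → w ∈ inner F
    ∈inner⁺ = ∈-tabulate-does⁺ (λ w → all? λ e → incident? e w →-dec e ∈? F)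

    ∈inner⁻ : w ∈ inner F → ∀ {e} → incident G e w → e ∈ F
    ∈inner⁻ w∈ {e} = ∈-tabulate-does⁻ (λ w → all? λ e → incident? e w →-dec e ∈? F) w∈ e

    ∉inner⁻ : w ∉ inner F → Σ (Fin m) λ e → incident G e w × e ∉ F
    ∉inner⁻ w∉ with ¬∀⟶∃¬ m _ (λ e → incident? e w →-dec e ∈? F) (w∉ ∘ ∈inner⁺)
    ... | e , ¬[ie⇒e∈F] with incident? e w
    ...   | yes ie = e , ie , λ e∈F → ¬[ie⇒e∈F] λ _ → e∈F
    ...   | no ¬ie = contradiction (λ ie → contradiction ie ¬ie) ¬[ie⇒e∈F]

  V-canB-⁅⁆ : ∀ u e → e ∈ V G (canB G ⁅ u ⁆)
  V-canB-⁅⁆ u e with src e ∈? ⁅ u ⁆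
  ... | no src∉  = ∈VcanB⁺ (inj₁ refl) src∉
  ... | yes src∈ = ∈VcanB⁺ (inj₂ refl) λ tgt∈ → loopless e (trans (x∈⁅y⁆⇒x≡y u src∈) (sym (x∈⁅y⁆⇒x≡y u tgt∈)))

  V-canB-∅ : ∀ e → e ∈ V G (canB G ∅)
  V-canB-∅ e = ∈VcanB⁺ (inj₁ refl) ∉⊥

  δ-⁅⁆⇒incident : ∀ {u e} → e ∈ δ G ⁅ u ⁆ → incident G e u
  δ-⁅⁆⇒incident {u} e∈δ = let _ , _ , ix , _ , x∈⁅u⁆ , _ = ∈δ⁻ e∈δ in subst (incident G _) (x∈⁅y⁆⇒x≡y u x∈⁅u⁆) ix

  ∣δ∅∣≡0 : ∣ δ G ∅ ∣ ≡ 0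
  ∣δ∅∣≡0 = trans (cong ∣_∣ (⊆-antisym δ∅⊆∅ ⊥⊆)) (∣⊥∣≡0 m)
    where
    δ∅⊆∅ : δ G ∅ ⊆ ∅
    δ∅⊆∅ e∈δ = let _ , _ , _ , _ , x∈∅ , _ = ∈δ⁻ e∈δ in contradiction x∈∅ ∉⊥

  δ-posimodular : ∀ X W → ∣ δ G (X ─ W) ∣ + ∣ δ G (W ─ X) ∣ ≤ ∣ δ G X ∣ + ∣ δ G W ∣
  δ-posimodular X W = ∣tabulate∣-+-mono λ e →
    subst₂ (λ a b → χ a + χ b ≤ χ (lookup X (src e) xor lookup X (tgt e)) + χ (lookup W (src e) xor lookup W (tgt e)))
      (sym (cong₂ _xor_ (lookup-─ X W (src e)) (lookup-─ X W (tgt e))))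
      (sym (cong₂ _xor_ (lookup-─ W X (src e)) (lookup-─ W X (tgt e))))
      (posimodularᵇ (lookup X (src e)) (lookup W (src e)) (lookup X (tgt e)) (lookup W (tgt e)))

module _ (G : Graph) {T : Subg G → Subg G → Set} {t : ℕ} (tangle : IsTangle G T t) where
  open Graph G
  open IsTangle tangle

  T-asymmetric : ∀ {A B} → IsSeparation G A B → T A B → ¬ T B A
  T-asymmetric {A} {B} (_ , _ , _ , covV , covE) tAB tBA =
    noCover A B B A A B tAB tBA tAB (map₂ inj₁ ∘ covV , λ e f → map₂ inj₁ ∘ covE e f)

  T-dec : ∀ {A B} → IsSeparation G A B → order G A B < t → Dec (T A B)
  T-dec {A} {B} sep o with orient A B sep o
  ... | inj₁ tAB = yes tAB
  ... | inj₂ tBA = no λ tAB → T-asymmetric sep tAB tBA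

  T-whole : ∀ {A B} → IsSeparation G A B → order G A B < t → (∀ e → e ∈ V G B) → T A B
  T-whole {A} {B} sep o whole with orient A B sep o
  ... | inj₁ tAB = tAB
  ... | inj₂ tBA = contradiction whole (notWhole B A tBA)

  T-by-cover : ∀ {A B A₁ B₁ A₃ B₃} → IsSeparation G A B → order G A B < t
    → T A₁ B₁ → T A₃ B₃ → CoverL3 G A₁ B A₃ → T A B
  T-by-cover {A} {B} {A₁} {B₁} {A₃} {B₃} sep o t₁ t₃ cover with orient A B sep o
  ... | inj₁ tAB = tAB
  ... | inj₂ tBA = contradiction cover (noCover A₁ B₁ B A A₃ B₃ t₁ tBA t₃)

  module _ (W : Subset n) (δ<t : ∣ δ G W ∣ < t) where

    private
      canonical-order<t : order G (canA G W) (canB G W) < t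
      canonical-order<t = subst (_< t) (sym (canonical-order G {W})) δ<t

    canonical∈T-whole : (∀ e → e ∈ V G (canB G W)) → T (canA G W) (canB G W)
    canonical∈T-whole = T-whole (canonical-isSeparation G {W}) canonical-order<t

    canonical∈T-by-cover : ∀ {A₁ B₁ A₃ B₃} → T A₁ B₁ → T A₃ B₃
      → (∀ e → e ∈ V G (canA G W) → e ∈ V G A₁ ⊎ e ∈ V G A₃)
      → (∀ e f → lineEdge G e f ≡ true → e ∈ V G (canA G W) → f ∈ V G (canA G W)
           → _∈E_ G (e , f) A₁ ⊎ _∈E_ G (e , f) A₃)
      → T (canA G W) (canB G W)
    canonical∈T-by-cover {A₁} {_} {A₃} t₁ t₃ covV covE =
      T-by-cover (canonical-isSeparation G {W}) canonical-order<t t₁ t₃ (covV′ , covE′)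
      where
      covV′ : ∀ e → e ∈ V G A₁ ⊎ e ∈ V G (canB G W) ⊎ e ∈ V G A₃
      covV′ e with e ∈? V G (canA G W)
      ... | yes e∈A = [ inj₁ , inj₂ ∘ inj₂ ]′ (covV e e∈A)
      ... | no e∉A  = inj₂ (inj₁ (∉VcanA⇒∈VcanB G {W} e∉A))
      covE′ : ∀ e f → lineEdge G e f ≡ true
        → _∈E_ G (e , f) A₁ ⊎ _∈E_ G (e , f) (canB G W) ⊎ _∈E_ G (e , f) A₃
      covE′ e f l with e ∈? V G (canA G W) | f ∈? V G (canA G W)
      ... | yes e∈A | yes f∈A = [ inj₁ , inj₂ ∘ inj₂ ]′ (covE e f l e∈A f∈A)
      ... | no e∉A  | _       = inj₂ (inj₁ (∈EcanB⁺ G {W} l (inj₁ e∉A)))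
      ... | yes _   | no f∉A  = inj₂ (inj₁ (∈EcanB⁺ G {W} l (inj₂ f∉A)))

  canonical∈T-⊆ : ∀ {W′ W} → W′ ⊆ W → T (canA G W) (canB G W) → ∣ δ G W′ ∣ < t → T (canA G W′) (canB G W′)
  canonical∈T-⊆ {W′} {W} W′⊆W tW δ<t = canonical∈T-by-cover W′ δ<t tW tW (λ _ → inj₁ ∘ grow) λ e f l e∈A f∈A →
    inj₁ (∈EcanA⁺ G {W} l (grow e∈A) (grow f∈A))
    where
    grow : ∀ {e} → e ∈ V G (canA G W′) → e ∈ V G (canA G W)
    grow e∈A′ = let _ , ie , x∈W′ = ∈VcanA⁻ G e∈A′ in ∈VcanA⁺ G ie (W′⊆W x∈W′)

  clique∈T : ∀ S → ∣ S ∣ < t → T (clique G S) (coclique G S)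
  clique∈T S S<t = T-whole (clique-isSeparation G) (≤-<-trans (∣p∩q∣≤∣p∣ S ⊤) S<t) (λ _ → ∈⊤)

  module _ {A B} (tAB : T A B) where

    private
      sep : IsSeparation G A B
      sep = proj₁ (members A B tAB)

      order<t : order G A B < t
      order<t = proj₂ (members A B tAB)

    center∈inner : ∀ {e₀ u} → incident G e₀ u → e₀ ∉ V G B → u ∈ inner G (V G A)
    center∈inner {e₀} ie₀ e₀∉B = ∈inner⁺ G λ e ie → decidable-stable (e ∈? V G A)
      λ e∉A → separation-nonadjacent G {A} {B} sep ie ie₀ e∉A e₀∉B

    δ-inner⊆A∩B : δ G (inner G (V G A)) ⊆ V G A ∩ V G B
    δ-inner⊆A∩B e∈δ with _ , _ , ix , iy , x∈W , y∉W ← ∈δ⁻ G e∈δ with g , ig , g∉A ← ∉inner⁻ G y∉W =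
      x∈p∩q⁺ (∈inner⁻ G x∈W ix , decidable-stable (_ ∈? V G B) λ e∉B → separation-nonadjacent G {A} {B} sep ig iy g∉A e∉B)

    inner∈T : T (canA G (inner G (V G A))) (canB G (inner G (V G A)))
    inner∈T = canonical∈T-by-cover W (≤-<-trans (p⊆q⇒∣p∣≤∣q∣ δ-inner⊆A∩B) order<t) tAB (clique∈T (V G A ∩ V G B) order<t)
      (λ _ → inj₁ ∘ inA) covE
      where
      W : Subset n
      W = inner G (V G A)
      inA : ∀ {e} → e ∈ V G (canA G W) → e ∈ V G A
      inA e∈ = let _ , ie , x∈W = ∈VcanA⁻ G e∈ in ∈inner⁻ G x∈W ie
      covE : ∀ e f → lineEdge G e f ≡ true → e ∈ V G (canA G W) → f ∈ V G (canA G W)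
        → _∈E_ G (e , f) A ⊎ _∈E_ G (e , f) (clique G (V G A ∩ V G B))
      covE e f l e∈ f∈ with (_ , subB , _ , _ , covE-sep) ← sep with covE-sep e f l
      ... | inj₁ ef∈A = inj₁ ef∈A
      ... | inj₂ ef∈B = let _ , e∈B , f∈B = subB e f ef∈B in
        inj₂ (∈Eclique⁺ G l (x∈p∩q⁺ (inA e∈ , e∈B)) (x∈p∩q⁺ (inA f∈ , f∈B)))

  blocked-star⇒canonical : ∀ {A B u F} → T A B → order G A B < ∣ F ∣ → F ⊆ V G A
    → (∀ e → e ∈ F → incident G e u)
    → Σ (Subset n) λ W → u ∈ W × ∣ δ G W ∣ < ∣ F ∣ × T (canA G W) (canB G W)
  blocked-star⇒canonical {A} {B} {u} {F} tAB o F⊆A star with any? (λ e → e ∈? F ×-dec ¬? (e ∈? V G B))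
  ... | yes (e₀ , e₀∈F , e₀∉B) = inner G (V G A) , center∈inner tAB (star e₀ e₀∈F) e₀∉B
                               , ≤-<-trans (p⊆q⇒∣p∣≤∣q∣ (δ-inner⊆A∩B tAB)) o , inner∈T tAB
  ... | no ∄e₀ = contradiction (p⊆q⇒∣p∣≤∣q∣ F⊆A∩B) (<⇒≱ o)
    where
    F⊆A∩B : F ⊆ V G A ∩ V G B
    F⊆A∩B {e} e∈F = x∈p∩q⁺ (F⊆A e∈F , decidable-stable (e ∈? V G B) λ e∉B → ∄e₀ (e , e∈F , e∉B))

  canonical-blocks-star : ∀ {W u F} → T (canA G W) (canB G W) → u ∈ W → ∣ δ G W ∣ < ∣ F ∣
    → (∀ e → e ∈ F → incident G e u) → ¬ Free G T F
  canonical-blocks-star {W} tW u∈W δ<∣F∣ star free = free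
    (canA G W , canB G W , tW , subst (_< _) (sym (canonical-order G {W})) δ<∣F∣ , λ {e} e∈F → ∈VcanA⁺ G (star e e∈F) u∈W)

  module _ {k : ℕ} (k<t : k < t) where

    record Good (W : Subset n) : Set where
      constructor good
      field
        δ<k : ∣ δ G W ∣ < k
        canonical∈T : T (canA G W) (canB G W)

    good-neighbourhood? : ∀ u W → Dec (u ∈ W × Good W)
    good-neighbourhood? u W with u ∈? W | ∣ δ G W ∣ <? k
    ... | no u∉W  | _       = no (u∉W ∘ proj₁)
    ... | yes _   | no δ≮k  = no (δ≮k ∘ Good.δ<k ∘ proj₂)
    ... | yes u∈W | yes δ<k = map′ (λ tW → u∈W , good δ<k tW) (Good.canonical∈T ∘ proj₂)
      (T-dec (canonical-isSeparation G {W}) (subst (_< t) (sym (canonical-order G {W})) (<-trans δ<k k<t)))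

    ∅-good : 1 ≤ k → Good ∅
    ∅-good 1≤k = good (subst (_< k) (sym (∣δ∅∣≡0 G)) 1≤k)
      (canonical∈T-whole ∅ (subst (_< t) (sym (∣δ∅∣≡0 G)) (<-trans 1≤k k<t)) (V-canB-∅ G))

    ⁅⁆-good : ∀ u → ∣ δ G ⁅ u ⁆ ∣ < k → Good ⁅ u ⁆
    ⁅⁆-good u δ<k = good δ<k (canonical∈T-whole ⁅ u ⁆ (<-trans δ<k k<t) (V-canB-⁅⁆ G u))

    -- Freeness is a negation, so a blocking separation cannot be read off from ¬ Free F; instead the
    -- finitely many candidate sets W are searched, and a blocking separation would produce one.
    good-neighbourhood : ∀ u → ¬ (Σ (Subset m) λ F → IsStar G k u F × Free G T F)
      → Σ (Subset n) λ W → u ∈ W × Good W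
    good-neighbourhood u no-free-star with ∣ δ G ⁅ u ⁆ ∣ <? k
    ... | yes δ<k = ⁅ u ⁆ , x∈⁅x⁆ u , ⁅⁆-good u δ<k
    ... | no δ≮k with anySubset? (good-neighbourhood? u)
    ...   | yes ∃good = ∃good
    ...   | no ∄good with F , F⊆δ , ∣F∣≡k ← ⊆-of-size (δ G ⁅ u ⁆) (≮⇒≥ δ≮k) =
      contradiction (F , (∣F∣≡k , star) , free) no-free-star
      where
      star : ∀ e → e ∈ F → incident G e u
      star _ = δ-⁅⁆⇒incident G ∘ F⊆δ
      free : Free G T F
      free (A , B , tAB , o , F⊆A) with W , u∈W , δ<∣F∣ , tW ← blocked-star⇒canonical tAB o F⊆A star =
        ∄good (W , u∈W , good (subst (∣ δ G W ∣ <_) ∣F∣≡k δ<∣F∣) tW)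

    record Uncrossing (X W : Subset n) : Set where
      field
        X′ W′ : Subset n
        X′-good : Good X′
        W′-good : Good W′
        X′⊆X : X′ ⊆ X
        W′⊆W : W′ ⊆ W
        disjoint : ∀ {x} → x ∈ X′ → x ∉ W′
        covers : ∀ {x} → x ∈ X ⊎ x ∈ W → x ∈ X′ ⊎ x ∈ W′

    uncrossing-swap : ∀ {X W} → Uncrossing W X → Uncrossing X W
    uncrossing-swap u = record
      { X′ = W′ ; W′ = X′ ; X′-good = W′-good ; W′-good = X′-good ; X′⊆X = W′⊆W ; W′⊆W = X′⊆X
      ; disjoint = λ x∈W′ x∈X′ → disjoint x∈X′ x∈W′ ; covers = swap ∘ covers ∘ swap }
      where open Uncrossing u

    uncross-by-difference : ∀ {X W} → Good X → Good W → ∣ δ G (X ─ W) ∣ ≤ ∣ δ G X ∣ → Uncrossing X W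
    uncross-by-difference {X} {W} (good δX<k tX) gW δ≤ = record
      { X′ = X ─ W ; W′ = W ; X′-good = good δ<k (canonical∈T-⊆ (p─q⊆p X W) tX (<-trans δ<k k<t))
      ; W′-good = gW ; X′⊆X = p─q⊆p X W ; W′⊆W = id ; disjoint = x∈p─q⇒x∉q ; covers = covers }
      where
      δ<k : ∣ δ G (X ─ W) ∣ < k
      δ<k = ≤-<-trans δ≤ δX<k
      covers : ∀ {x} → x ∈ X ⊎ x ∈ W → x ∈ X ─ W ⊎ x ∈ W
      covers (inj₂ x∈W) = inj₂ x∈W
      covers {x} (inj₁ x∈X) with x ∈? W
      ... | yes x∈W = inj₂ x∈W
      ... | no x∉W  = inj₁ (x∈p∧x∉q⇒x∈p─q x∈X x∉W)

    uncross : ∀ {X W} → Good X → Good W → Uncrossing X W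
    uncross {X} {W} gX gW with +-≤-split (δ-posimodular G X W)
    ... | inj₁ δ≤ = uncross-by-difference gX gW δ≤
    ... | inj₂ δ≤ = uncrossing-swap (uncross-by-difference gW gX δ≤)

    record Insertion (W : Subset n) {l} (g : Fin l → Subset n) : Set where
      field
        W′ : Subset n
        g′ : Fin l → Subset n
        W′-good : Good W′
        g′-good : ∀ i → Good (g′ i)
        W′⊆W : W′ ⊆ W
        g′⊆g : ∀ i → g′ i ⊆ g i
        disjoint : ∀ i {x} → x ∈ W′ → x ∉ g′ i
        covers : ∀ {x} → x ∈ W ⊎ x ∈⋃ g → x ∈ W′ ⊎ x ∈⋃ g′

    insert : ∀ {l W} {g : Fin l → Subset n} → Good W → (∀ i → Good (g i)) → Insertion W g
    insert {zero} {W} {g} gW _ = record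
      { W′ = W ; g′ = g ; W′-good = gW ; g′-good = λ () ; W′⊆W = id ; g′⊆g = λ ()
      ; disjoint = λ () ; covers = id }
    insert {suc l} {W} {g} gW gg = record
      { W′ = I.W′ ; g′ = U.X′ ∷ᶠ I.g′ ; W′-good = I.W′-good ; g′-good = g′-good
      ; W′⊆W = U.W′⊆W ∘ I.W′⊆W ; g′⊆g = g′⊆g ; disjoint = disjoint ; covers = covers }
      where
      module U = Uncrossing (uncross (gg zero) gW)
      module I = Insertion (insert U.W′-good (gg ∘ suc))
      g′-good : ∀ i → Good ((U.X′ ∷ᶠ I.g′) i)
      g′-good zero    = U.X′-good
      g′-good (suc i) = I.g′-good i
      g′⊆g : ∀ i → (U.X′ ∷ᶠ I.g′) i ⊆ g i
      g′⊆g zero    = U.X′⊆X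
      g′⊆g (suc i) = I.g′⊆g i
      disjoint : ∀ i {x} → x ∈ I.W′ → x ∉ (U.X′ ∷ᶠ I.g′) i
      disjoint zero    x∈W′ x∈X′ = U.disjoint x∈X′ (I.W′⊆W x∈W′)
      disjoint (suc i) = I.disjoint i
      shift : ∀ {x} → x ∈ I.W′ ⊎ x ∈⋃ I.g′ → x ∈ I.W′ ⊎ x ∈⋃ (U.X′ ∷ᶠ I.g′)
      shift = map₂ λ (i , x∈) → suc i , x∈
      via-U : ∀ {x} → x ∈ g zero ⊎ x ∈ W → x ∈ I.W′ ⊎ x ∈⋃ (U.X′ ∷ᶠ I.g′)
      via-U = [ (λ x∈X′ → inj₂ (zero , x∈X′)) , shift ∘ I.covers ∘ inj₁ ]′ ∘ U.covers
      covers : ∀ {x} → x ∈ W ⊎ x ∈⋃ g → x ∈ I.W′ ⊎ x ∈⋃ (U.X′ ∷ᶠ I.g′)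
      covers (inj₁ x∈W)          = via-U (inj₂ x∈W)
      covers (inj₂ (zero , x∈))  = via-U (inj₁ x∈)
      covers (inj₂ (suc i , x∈)) = shift (I.covers (inj₂ (i , x∈)))

    record Disjointification {l} (f : Fin l → Subset n) : Set where
      field
        g : Fin l → Subset n
        g-good : ∀ i → Good (g i)
        disjoint : ∀ i j → i Data.Fin.< j → ∀ x → ¬ (x ∈ g i × x ∈ g j)
        covers : ∀ {x} → x ∈⋃ f → x ∈⋃ g

    disjointify : ∀ {l} {f : Fin l → Subset n} → (∀ i → Good (f i)) → Disjointification f
    disjointify {zero} _ = record { g = λ () ; g-good = λ () ; disjoint = λ () ; covers = λ { (() , _) } }
    disjointify {suc l} {f} gf = record
      { g = I.W′ ∷ᶠ I.g′ ; g-good = g-good ; disjoint = disjoint ; covers = covers }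
      where
      module D = Disjointification (disjointify (gf ∘ suc))
      module I = Insertion (insert (gf zero) D.g-good)
      g-good : ∀ i → Good ((I.W′ ∷ᶠ I.g′) i)
      g-good zero    = I.W′-good
      g-good (suc i) = I.g′-good i
      disjoint : ∀ i j → i Data.Fin.< j → ∀ x → ¬ (x ∈ (I.W′ ∷ᶠ I.g′) i × x ∈ (I.W′ ∷ᶠ I.g′) j)
      disjoint zero    (suc j) _         x (x∈W′ , x∈g′) = I.disjoint j x∈W′ x∈g′
      disjoint (suc i) (suc j) (s≤s i<j) x (x∈i , x∈j)  = D.disjoint i j i<j x (I.g′⊆g i x∈i , I.g′⊆g j x∈j)
      cons : ∀ {x} → x ∈ I.W′ ⊎ x ∈⋃ I.g′ → x ∈⋃ (I.W′ ∷ᶠ I.g′)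
      cons = [ (λ x∈W′ → zero , x∈W′) , (λ (i , x∈) → suc i , x∈) ]′
      covers : ∀ {x} → x ∈⋃ f → x ∈⋃ (I.W′ ∷ᶠ I.g′)
      covers (zero , x∈)  = cons (I.covers (inj₁ x∈))
      covers (suc i , x∈) = cons (I.covers (inj₂ (D.covers (i , x∈))))

    good-cover : 1 ≤ k → ∀ {U} → (∀ u → u ∈ U → Σ (Subset n) λ W → u ∈ W × Good W)
      → Σ ℕ λ l → 1 ≤ l × (Σ (Fin l → Subset n) λ Us →
          (∀ i j → i Data.Fin.< j → ∀ x → ¬ (x ∈ Us i × x ∈ Us j))
          × (∀ x → x ∈ U → Σ (Fin l) λ i → x ∈ Us i)
          × (∀ i → ∣ δ G (Us i) ∣ < k)
          × (∀ i → T (canA G (Us i)) (canB G (Us i))))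
    good-cover 1≤k {U} neighbourhood =
      suc n , s≤s z≤n , D.g , D.disjoint , covers , Good.δ<k ∘ D.g-good , Good.canonical∈T ∘ D.g-good
      where
      choose : ∀ u → Σ (Subset n) λ W → (u ∈ U → u ∈ W) × Good W
      choose u with u ∈? U
      ... | yes u∈U = let W , u∈W , gW = neighbourhood u u∈U in W , const u∈W , gW
      ... | no u∉U  = ∅ , (λ u∈U → contradiction u∈U u∉U) , ∅-good 1≤k
      -- ∅ pads the family so that l ≥ 1 even when G has no vertices.
      f : Fin (suc n) → Subset n
      f = ∅ ∷ᶠ (proj₁ ∘ choose)
      f-good : ∀ i → Good (f i)
      f-good zero    = ∅-good 1≤k
      f-good (suc u) = proj₂ (proj₂ (choose u))
      module D = Disjointification (disjointify f-good)
      covers : ∀ x → x ∈ U → x ∈⋃ D.g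
      covers x x∈U = D.covers (suc x , proj₁ (proj₂ (choose x)) x∈U)

lemma2 : (G : Graph) (t k : ℕ) → 1 ≤ k → k < t
    → (T : Subg G → Subg G → Set) → IsTangle G T t
    → (U : Subset (Graph.n G))
    → (¬ (Σ (Fin (Graph.n G)) λ u → u ∈ U × (Σ (Subset (Graph.m G)) λ F → IsStar G k u F × Free G T F)))
    ⇔ (Σ ℕ λ l → 1 ≤ l × (Σ (Fin l → Subset (Graph.n G)) λ Us →
    (∀ i j → i Data.Fin.< j → ∀ x → ¬ (x ∈ Us i × x ∈ Us j))
    × (∀ x → x ∈ U → Σ (Fin l) λ i → x ∈ Us i)
    × (∀ i → ∣ δ G (Us i) ∣ < k)
    × (∀ i → T (canA G (Us i)) (canB G (Us i)))))
lemma2 G t k 1≤k k<t T tangle U = mk⇔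
  (λ no-free-star → good-cover G tangle k<t 1≤k λ u u∈U →
    good-neighbourhood G tangle k<t u λ (F , star , free) → no-free-star (u , u∈U , F , star , free))
  λ (_ , _ , Us , _ , covers , δ<k , tUs) (u , u∈U , F , (∣F∣≡k , star) , free) →
    let i , u∈Ui = covers u u∈U
    in canonical-blocks-star G tangle (tUs i) u∈Ui (subst (∣ δ G (Us i) ∣ <_) (sym ∣F∣≡k) (δ<k i)) star free
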